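{- Let $X$ be a finite non-empty set and $R$ a monotone transit function on $X$ satisfying (w): for all $x,y,z\in X$, $z\in R(x,y)$ or $y\in R(x,z)$ or $x\in R(y,z)$. Then $R$ satisfies (x'): for all $x,y,z\in X$, if $z\notin R(x,y)$ then $R(x,y)\subseteq R(x,z)\cup R(z,y)$.
   Context: A transit function on a finite non-empty set $X$ is a map $R:X\times X\to 2^X$ such that for all $u,v\in X$: $u\in R(u,v)$, $R(u,v)=R(v,u)$, and $R(u,u)=\{u\}$. $R$ is monotone if for all $u,v,p,q\in X$, $p,q\in R(u,v)$ implies $R(p,q)\subseteq R(u,v)$. -}

module Defs where

open import Data.Nat using (ℕ)
open import Data.Fin using (Fin)
open import Data.Fin.Subset using (Subset; _∈_; _∉_; _⊆_; _∪_; ⁅_⁆)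
open import Data.Product using (_×_)
open import Data.Sum using (_⊎_)
open import Relation.Binary.PropositionalEquality using (_≡_)

record IsTransit {n : ℕ} (R : Fin n → Fin n → Subset n) : Set where
  field
    ext  : ∀ u v → u ∈ R u v
    symm : ∀ u v → R u v ≡ R v u
    idem : ∀ u → R u u ≡ ⁅ u ⁆

Monotone : {n : ℕ} → (Fin n → Fin n → Subset n) → Set
Monotone R = ∀ u v p q → p ∈ R u v → q ∈ R u v → R p q ⊆ R u v

AxiomW : {n : ℕ} → (Fin n → Fin n → Subset n) → Set
AxiomW R = ∀ x y z → z ∈ R x y ⊎ (y ∈ R x z ⊎ x ∈ R y z)

AxiomX' : {n : ℕ} → (Fin n → Fin n → Subset n) → Set
AxiomX' R = ∀ x y z → z ∉ R x y → R x y ⊆ (R x z ∪ R z y)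

{-# OPTIONS --safe #-}
module Submission where

-- Of the three cases of (w), z ∈ R(x,y) is excluded; if y ∈ R(x,z) (resp.
-- x ∈ R(z,y)), monotonicity applied to that point and the shared end point
-- gives R(x,y) ⊆ R(x,z) (resp. R(x,y) ⊆ R(z,y)).

open import Defs
open import Data.Nat using (ℕ; suc)
open import Data.Fin using (Fin)
open import Data.Fin.Subset using (Subset; _∈_; _⊆_)
open import Data.Fin.Subset.Properties using (p⊆p∪q; q⊆p∪q)
open import Data.Sum using (inj₁; inj₂)
open import Function using (_∘_)
open import Relation.Binary.PropositionalEquality using (subst)
open import Relation.Nullary using (contradiction)

module _ {n : ℕ} {R : Fin n → Fin n → Subset n}
         (transit : IsTransit R) (monotone : Monotone R) where

  open IsTransit transit

  ext′ : ∀ u v → v ∈ R u v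
  ext′ u v = subst (v ∈_) (symm v u) (ext v u)

  R-⊆ˡ : ∀ {x y z} → y ∈ R x z → R x y ⊆ R x z
  R-⊆ˡ {x} {y} {z} y∈Rxz = monotone x z x y (ext x z) y∈Rxz

  R-⊆ʳ : ∀ {x y z} → x ∈ R z y → R x y ⊆ R z y
  R-⊆ʳ {x} {y} {z} x∈Rzy = monotone z y x y x∈Rzy (ext′ z y)

lemma1 : (n : ℕ) (R : Fin (suc n) → Fin (suc n) → Subset (suc n)) →
    IsTransit R → Monotone R → AxiomW R → AxiomX' R
lemma1 n R transit monotone w x y z z∉Rxy with w x y z
... | inj₁ z∈Rxy        = contradiction z∈Rxy z∉Rxy
... | inj₂ (inj₁ y∈Rxz) = p⊆p∪q (R z y) ∘ R-⊆ˡ transit monotone y∈Rxz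
... | inj₂ (inj₂ x∈Ryz) =
  q⊆p∪q (R x z) (R z y) ∘ R-⊆ʳ transit monotone (subst (x ∈_) (symm y z) x∈Ryz)
  where open IsTransit transit
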